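{- Let $f(x) = 1 + h_1x + h_2x^2 + \cdots$ be the unique power series with all $h_n \in \{1,2,3\}$ ($n\ge1$) that is the cube of an element of $R$, and let $g(x) = \sum_{n \ge 0} g_n x^n$ with $g_n \in \{0,1,2\}$ be obtained by reducing the coefficients of $f^{1/3} \in R$ modulo $3$. Write $g = g_+ + 2 g_-$, where $g_+(x) := \sum_{n: g_n = 1} x^n$ and $g_-(x) := \sum_{n : g_n = 2} x^n$. Then $g(0) = 1$, $$2g_+(x^3) + g_-(x^3) + g(x)^3 \equiv \frac{3}{1-x} \pmod{9},$$ and $$f(x) \equiv \frac{3}{1-x} - 2g_+(x^3) - g_-(x^3) \pmod{9}.$$
   Context: $R := 1 + x\mathbb{Z}[[x]]$ is the set of formal power series with integer coefficients and constant term $1$. Congruences of power series mod an integer are coefficientwise; $\frac{3}{1-x} = \sum_{n\ge0} 3x^n$. -}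

module Defs where

open import Data.Nat as ℕ using (ℕ; zero; suc)
open import Data.Integer as ℤ using (ℤ; +_; _+_; _*_; _-_; _%ℕ_)
open import Data.Integer.Divisibility using (_∣_)
open import Data.List using (List; []; _∷_; foldr; map; upTo)
open import Data.Bool using (if_then_else_)

Series : Set
Series = ℕ → ℤ

-- Membership in R = 1 + x ℤ[[x]].
InR : Series → Set
InR p = p 0 ≡ + 1
  where open import Relation.Binary.PropositionalEquality using (_≡_)

_⋆_ : Series → Series → Series
(p ⋆ q) n = foldr _+_ (+ 0) (map (λ i → p i * q (n ℕ.∸ i)) (upTo (suc n)))

cube : Series → Series
cube p = p ⋆ (p ⋆ p)

_≡[mod_]_ : Series → ℤ → Series → Set
p ≡[mod m ] q = ∀ n → m ∣ (p n - q n)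

mod3 : Series → Series
mod3 p n = + (p n %ℕ 3)

indicator : ℤ → Series → Series
indicator c p n = if ⌊ p n ℤ.≟ c ⌋ then + 1 else + 0
  where open import Relation.Nullary.Decidable using (⌊_⌋)

subst-x³ : Series → Series
subst-x³ p n = if ⌊ n ℕ.% 3 ℕ.≟ 0 ⌋ then p (n ℕ./ 3) else + 0
  where open import Relation.Nullary.Decidable using (⌊_⌋)

three/1-x : Series
three/1-x _ = + 3

module Submission where

-- Write a = g + 3d with g = mod3 a. Expanding (g + 3d)³ gives f = a³ ≡ g³ (mod 9). Modulo 3,
-- cubing is additive, (u + v)³ ≡ u³ + v³, and fixes every integer (Fermat), so g³ ≡ g(x³) (mod 3)
-- and hence f ≡ g(x³) (mod 3). As the coefficients of f lie in {1,2,3} and those of g(x³) in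
-- {0,1,2}, this congruence pins f down exactly: f = 3/(1-x) - 2g₊(x³) - g₋(x³). Substituting this
-- into f ≡ g³ (mod 9) gives the first congruence.

open import Defs
open import Algebra.Bundles using (CommutativeSemiring)
open import Data.Bool using (Bool; true; false; if_then_else_)
open import Data.Bool.Properties using (if-float; if-cong-else)
open import Data.Integer as ℤ using (ℤ; +_; -[1+_]; _+_; _*_; _-_; -_; 0ℤ; 1ℤ)
open import Data.Integer.Divisibility.Signed
  using (_∣_; _∣?_; divides; ∣⇒∣ᵤ; ∣-trans; ∣m∣n⇒∣m+n; ∣m⇒∣-m)
open import Data.Integer.DivMod using (a≡a%ℕn+[a/ℕn]*n; n%ℕd<d)
import Data.Integer.Properties as ℤ
open import Data.Integer.Tactic.RingSolver using (solve-∀)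
open import Data.List using (foldr; applyUpTo)
open import Data.List.Properties using (map-upTo)
open import Data.Nat as ℕ using (ℕ; zero; suc)
import Data.Nat.DivMod as ℕ
import Data.Nat.Properties as ℕ
open import Data.Product using (Σ; _×_; _,_; proj₁; proj₂)
open import Data.Sum using (_⊎_; inj₁; inj₂)
open import Function using (_∘_)
open import Relation.Binary.Bundles using (Setoid)
open import Relation.Binary.PropositionalEquality
open import Relation.Nullary using (¬_)
open import Relation.Nullary.Decidable using (⌊_⌋; False; toWitnessFalse; isYes≗does; dec-false)
open import Relation.Nullary.Negation using (contradiction)

open import Algebra.Properties.CommutativeSemigroup ℤ.+-commutativeSemigroup
  using (interchange; x∙yz≈y∙xz)

-- Formal power series as a commutative semiring

infixl 6 _⊕_
infixl 7 _⊛_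

tail : Series → Series
tail p n = p (suc n)

shift : Series → Series
shift p zero    = 0ℤ
shift p (suc n) = p n

const : ℤ → Series
const c zero    = c
const c (suc n) = 0ℤ

scale : ℤ → Series → Series
scale c p n = c * p n

_⊕_ : Series → Series → Series
(p ⊕ q) n = p n + q n

-- The Cauchy product ⋆ in recursive form (see ⋆≗⊛).
_⊛_ : Series → Series → Series
(p ⊛ q) zero    = p 0 * q 0
(p ⊛ q) (suc n) = p 0 * q (suc n) + (tail p ⊛ q) n

⊛-cong : ∀ {p p′ q q′} → p ≗ p′ → q ≗ q′ → p ⊛ q ≗ p′ ⊛ q′
⊛-cong p≗p′ q≗q′ zero    = cong₂ _*_ (p≗p′ 0) (q≗q′ 0)
⊛-cong p≗p′ q≗q′ (suc n) =
  cong₂ _+_ (cong₂ _*_ (p≗p′ 0) (q≗q′ (suc n))) (⊛-cong (p≗p′ ∘ suc) q≗q′ n)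

⊛-distribʳ-⊕ : ∀ p q r → (q ⊕ r) ⊛ p ≗ q ⊛ p ⊕ r ⊛ p
⊛-distribʳ-⊕ p q r zero    = ℤ.*-distribʳ-+ (p 0) (q 0) (r 0)
⊛-distribʳ-⊕ p q r (suc n) = begin
  (q 0 + r 0) * p (suc n) + ((tail q ⊕ tail r) ⊛ p) n
    ≡⟨ cong₂ _+_ (ℤ.*-distribʳ-+ (p (suc n)) (q 0) (r 0)) (⊛-distribʳ-⊕ p (tail q) (tail r) n) ⟩
  (q 0 * p (suc n) + r 0 * p (suc n)) + ((tail q ⊛ p) n + (tail r ⊛ p) n)
    ≡⟨ interchange (q 0 * p (suc n)) (r 0 * p (suc n)) ((tail q ⊛ p) n) ((tail r ⊛ p) n) ⟩
  (q ⊛ p ⊕ r ⊛ p) (suc n) ∎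
  where open ≡-Reasoning

⊛-distribˡ-⊕ : ∀ p q r → p ⊛ (q ⊕ r) ≗ p ⊛ q ⊕ p ⊛ r
⊛-distribˡ-⊕ p q r zero    = ℤ.*-distribˡ-+ (p 0) (q 0) (r 0)
⊛-distribˡ-⊕ p q r (suc n) = begin
  p 0 * (q (suc n) + r (suc n)) + (tail p ⊛ (q ⊕ r)) n
    ≡⟨ cong₂ _+_ (ℤ.*-distribˡ-+ (p 0) (q (suc n)) (r (suc n))) (⊛-distribˡ-⊕ (tail p) q r n) ⟩
  (p 0 * q (suc n) + p 0 * r (suc n)) + ((tail p ⊛ q) n + (tail p ⊛ r) n)
    ≡⟨ interchange (p 0 * q (suc n)) (p 0 * r (suc n)) ((tail p ⊛ q) n) ((tail p ⊛ r) n) ⟩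
  (p ⊛ q ⊕ p ⊛ r) (suc n) ∎
  where open ≡-Reasoning

⊕-congˡ : ∀ p {q r} → q ≗ r → p ⊕ q ≗ p ⊕ r
⊕-congˡ p q≗r n = cong (_+_ (p n)) (q≗r n)

scale-⊛ : ∀ c p q → scale c p ⊛ q ≗ scale c (p ⊛ q)
scale-⊛ c p q zero    = ℤ.*-assoc c (p 0) (q 0)
scale-⊛ c p q (suc n) = begin
  c * p 0 * q (suc n) + (scale c (tail p) ⊛ q) n
    ≡⟨ cong₂ _+_ (ℤ.*-assoc c (p 0) (q (suc n))) (scale-⊛ c (tail p) q n) ⟩
  c * (p 0 * q (suc n)) + c * (tail p ⊛ q) n
    ≡⟨ ℤ.*-distribˡ-+ c _ _ ⟨
  scale c (p ⊛ q) (suc n) ∎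
  where open ≡-Reasoning

0ₛ 1ₛ : Series
0ₛ _ = 0ℤ
1ₛ = const 1ℤ

⊛-zeroˡ : ∀ p → 0ₛ ⊛ p ≗ 0ₛ
⊛-zeroˡ p zero    = refl
⊛-zeroˡ p (suc n) = cong (_+_ 0ℤ) (⊛-zeroˡ p n)

⊛-zeroʳ : ∀ p → p ⊛ 0ₛ ≗ 0ₛ
⊛-zeroʳ p zero    = ℤ.*-zeroʳ (p 0)
⊛-zeroʳ p (suc n) = cong₂ _+_ (ℤ.*-zeroʳ (p 0)) (⊛-zeroʳ (tail p) n)

const-⊛ : ∀ c p → const c ⊛ p ≗ scale c p
const-⊛ c p zero    = refl
const-⊛ c p (suc n) = trans (cong (_+_ (c * p (suc n))) (⊛-zeroˡ p n)) (ℤ.+-identityʳ _)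

⊛-identityˡ : ∀ p → 1ₛ ⊛ p ≗ p
⊛-identityˡ p n = trans (const-⊛ 1ℤ p n) (ℤ.*-identityˡ (p n))

⊛-unfoldˡ : ∀ p q → p ⊛ q ≗ scale (p 0) q ⊕ shift (tail p ⊛ q)
⊛-unfoldˡ p q zero    = sym (ℤ.+-identityʳ _)
⊛-unfoldˡ p q (suc n) = refl

⊛-unfoldʳ : ∀ p q → p ⊛ q ≗ scale (q 0) p ⊕ shift (p ⊛ tail q)
⊛-unfoldʳ p q zero    = trans (ℤ.*-comm (p 0) (q 0)) (sym (ℤ.+-identityʳ _))
⊛-unfoldʳ p q (suc n) = begin
  p 0 * q (suc n) + (tail p ⊛ q) n
    ≡⟨ cong (_+_ (p 0 * q (suc n))) (⊛-unfoldʳ (tail p) q n) ⟩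
  p 0 * q (suc n) + (q 0 * p (suc n) + shift (tail p ⊛ tail q) n)
    ≡⟨ x∙yz≈y∙xz (p 0 * q (suc n)) (q 0 * p (suc n)) (shift (tail p ⊛ tail q) n) ⟩
  q 0 * p (suc n) + (p 0 * q (suc n) + shift (tail p ⊛ tail q) n)
    ≡⟨ cong (_+_ (q 0 * p (suc n))) (⊛-unfoldˡ p (tail q) n) ⟨
  (scale (q 0) p ⊕ shift (p ⊛ tail q)) (suc n) ∎
  where open ≡-Reasoning

⊛-comm : ∀ p q → p ⊛ q ≗ q ⊛ p
⊛-comm p q zero    = ℤ.*-comm (p 0) (q 0)
⊛-comm p q (suc n) = begin
  p 0 * q (suc n) + (tail p ⊛ q) n
    ≡⟨ cong (_+_ (p 0 * q (suc n))) (⊛-unfoldʳ (tail p) q n) ⟩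
  p 0 * q (suc n) + (q 0 * p (suc n) + shift (tail p ⊛ tail q) n)
    ≡⟨ cong (λ r → p 0 * q (suc n) + (q 0 * p (suc n) + r)) (shift-comm n) ⟩
  p 0 * q (suc n) + (q 0 * p (suc n) + shift (tail q ⊛ tail p) n)
    ≡⟨ x∙yz≈y∙xz (p 0 * q (suc n)) (q 0 * p (suc n)) (shift (tail q ⊛ tail p) n) ⟩
  q 0 * p (suc n) + (p 0 * q (suc n) + shift (tail q ⊛ tail p) n)
    ≡⟨ cong (_+_ (q 0 * p (suc n))) (⊛-unfoldʳ (tail q) p n) ⟨
  (q ⊛ p) (suc n) ∎
  where
  open ≡-Reasoning
  shift-comm : shift (tail p ⊛ tail q) ≗ shift (tail q ⊛ tail p)
  shift-comm zero    = refl
  shift-comm (suc m) = ⊛-comm (tail p) (tail q) m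

⊛-assoc : ∀ p q r → (p ⊛ q) ⊛ r ≗ p ⊛ (q ⊛ r)
⊛-assoc p q r zero    = ℤ.*-assoc (p 0) (q 0) (r 0)
⊛-assoc p q r (suc n) = begin
  p 0 * q 0 * r (suc n) + ((scale (p 0) (tail q) ⊕ tail p ⊛ q) ⊛ r) n
    ≡⟨ cong (_+_ (p 0 * q 0 * r (suc n))) (⊛-distribʳ-⊕ r (scale (p 0) (tail q)) (tail p ⊛ q) n) ⟩
  p 0 * q 0 * r (suc n) + ((scale (p 0) (tail q) ⊛ r) n + (tail p ⊛ q ⊛ r) n)
    ≡⟨ cong₂ (λ s t → p 0 * q 0 * r (suc n) + (s + t)) (scale-⊛ (p 0) (tail q) r n) (⊛-assoc (tail p) q r n) ⟩
  p 0 * q 0 * r (suc n) + (p 0 * (tail q ⊛ r) n + (tail p ⊛ (q ⊛ r)) n)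
    ≡⟨ rearrange (p 0) (q 0) (r (suc n)) _ _ ⟩
  (p ⊛ (q ⊛ r)) (suc n) ∎
  where
  open ≡-Reasoning
  rearrange : ∀ a b c d e → a * b * c + (a * d + e) ≡ a * (b * c + d) + e
  rearrange = solve-∀

⊛-identityʳ : ∀ p → p ⊛ 1ₛ ≗ p
⊛-identityʳ p n = trans (⊛-comm p 1ₛ n) (⊛-identityˡ p n)

series-commutativeSemiring : CommutativeSemiring _ _
series-commutativeSemiring = record
  { Carrier = Series
  ; _≈_     = _≗_
  ; _+_     = _⊕_
  ; _*_     = _⊛_
  ; 0#      = 0ₛ
  ; 1#      = 1ₛ
  ; isCommutativeSemiring = record
    { isSemiring = record
      { isSemiringWithoutAnnihilatingZero = record
        { +-isCommutativeMonoid = record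
          { isMonoid = record
            { isSemigroup = record
              { isMagma = record
                { isEquivalence = Setoid.isEquivalence (ℕ →-setoid ℤ)
                ; ∙-cong = λ p≗p′ q≗q′ n → cong₂ _+_ (p≗p′ n) (q≗q′ n)
                }
              ; assoc = λ p q r n → ℤ.+-assoc (p n) (q n) (r n)
              }
            ; identity = (λ p n → ℤ.+-identityˡ (p n)) , (λ p n → ℤ.+-identityʳ (p n))
            }
          ; comm = λ p q n → ℤ.+-comm (p n) (q n)
          }
        ; *-cong     = ⊛-cong
        ; *-assoc    = ⊛-assoc
        ; *-identity = ⊛-identityˡ , ⊛-identityʳ
        ; distrib    = ⊛-distribˡ-⊕ , ⊛-distribʳ-⊕
        }
      ; zero = ⊛-zeroˡ , ⊛-zeroʳ
      }
    ; *-comm = ⊛-comm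
    }
  }

⋆≗⊛ : ∀ p q → p ⋆ q ≗ p ⊛ q
⋆≗⊛ p q n = trans (cong (foldr _+_ 0ℤ) (map-upTo (λ i → p i * q (n ℕ.∸ i)) (suc n))) (sum≡⊛ n p q)
  where
  sum≡⊛ : ∀ n p q → foldr _+_ 0ℤ (applyUpTo (λ i → p i * q (n ℕ.∸ i)) (suc n)) ≡ (p ⊛ q) n
  sum≡⊛ zero    p q = ℤ.+-identityʳ _
  sum≡⊛ (suc n) p q = cong (_+_ (p 0 * q (suc n))) (sum≡⊛ n (tail p) q)

shift-cong : ∀ {p q} → p ≗ q → shift p ≗ shift q
shift-cong p≗q zero    = refl
shift-cong p≗q (suc n) = p≗q n

shift-⊛ : ∀ p q → shift p ⊛ q ≗ shift (p ⊛ q)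
shift-⊛ p q zero    = ℤ.*-zeroˡ (q 0)
shift-⊛ p q (suc n) = trans (cong (_+ (p ⊛ q) n) (ℤ.*-zeroˡ (q (suc n)))) (ℤ.+-identityˡ _)

⊛-shift : ∀ p q → p ⊛ shift q ≗ shift (p ⊛ q)
⊛-shift p q n = trans (⊛-comm p (shift q) n) (trans (shift-⊛ q p n) (shift-cong (⊛-comm q p) n))

const-⊛-const : ∀ a b → const a ⊛ const b ≗ const (a * b)
const-⊛-const a b zero    = refl
const-⊛-const a b (suc n) = trans (cong₂ _+_ (ℤ.*-zeroʳ a) (⊛-zeroˡ (const b) n)) (ℤ.+-identityʳ 0ℤ)

≗const⊕shift-tail : ∀ p → p ≗ const (p 0) ⊕ shift (tail p)
≗const⊕shift-tail p zero    = sym (ℤ.+-identityʳ (p 0))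
≗const⊕shift-tail p (suc n) = sym (ℤ.+-identityˡ (p (suc n)))

-- Congruences modulo an integer

infix 4 _≡_[mod_]

-- A record rather than m ∣ a - b itself, so that a, b and m can be inferred from a proof.
record _≡_[mod_] (a b m : ℤ) : Set where
  constructor ≡-mod
  field divides-difference : m ∣ a - b

open _≡_[mod_]

≡-mod-reflexive : ∀ {m a b} → a ≡ b → a ≡ b [mod m ]
≡-mod-reflexive {m} a≡b = ≡-mod (divides 0ℤ (trans (ℤ.i≡j⇒i-j≡0 a≡b) (sym (ℤ.*-zeroˡ m))))

≡-mod-sym : ∀ {m a b} → a ≡ b [mod m ] → b ≡ a [mod m ]
≡-mod-sym {m} {a} {b} (≡-mod m∣a-b) = ≡-mod (subst (m ∣_) (-[a-b]≡b-a a b) (∣m⇒∣-m m∣a-b))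
  where
  -[a-b]≡b-a : ∀ a b → - (a - b) ≡ b - a
  -[a-b]≡b-a = solve-∀

≡-mod-trans : ∀ {m a b c} → a ≡ b [mod m ] → b ≡ c [mod m ] → a ≡ c [mod m ]
≡-mod-trans {m} {a} {b} {c} (≡-mod m∣a-b) (≡-mod m∣b-c) =
  ≡-mod (subst (m ∣_) (ℤ.+-minus-telescope a b c) (∣m∣n⇒∣m+n m∣a-b m∣b-c))

≡-mod-setoid : ℤ → Setoid _ _
≡-mod-setoid m = record
  { Carrier       = ℤ
  ; _≈_           = _≡_[mod m ]
  ; isEquivalence = record
    { refl  = ≡-mod-reflexive refl
    ; sym   = ≡-mod-sym
    ; trans = ≡-mod-trans
    }
  }

≡-mod-weaken : ∀ {k m a b} → k ∣ m → a ≡ b [mod m ] → a ≡ b [mod k ]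
≡-mod-weaken k∣m (≡-mod m∣a-b) = ≡-mod (∣-trans k∣m m∣a-b)

+-*-≡-mod : ∀ m a k → a + m * k ≡ a [mod m ]
+-*-≡-mod m a k = ≡-mod (divides k (a+m*k-a≡k*m a m k))
  where
  a+m*k-a≡k*m : ∀ a m k → a + m * k - a ≡ k * m
  a+m*k-a≡k*m = solve-∀

+-congˡ-≡-mod : ∀ {m a b} c → a ≡ b [mod m ] → c + a ≡ c + b [mod m ]
+-congˡ-≡-mod {m} {a} {b} c (≡-mod m∣a-b) = ≡-mod (subst (m ∣_) (sym (c+a-[c+b]≡a-b c a b)) m∣a-b)
  where
  c+a-[c+b]≡a-b : ∀ c a b → c + a - (c + b) ≡ a - b
  c+a-[c+b]≡a-b = solve-∀

≡-mod-rearrange : ∀ {m a b} c u v → a ≡ b [mod m ] → a ≡ c - u - v → u + v + b ≡ c [mod m ]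
≡-mod-rearrange {m} {a} {b} c u v a≡b a≡c-u-v = begin
  u + v + b           ≈⟨ +-congˡ-≡-mod (u + v) (≡-mod-sym a≡b) ⟩
  u + v + a           ≡⟨ cong (_+_ (u + v)) a≡c-u-v ⟩
  u + v + (c - u - v) ≡⟨ cancel c u v ⟩
  c                   ∎
  where
  open import Relation.Binary.Reasoning.Setoid (≡-mod-setoid m)
  cancel : ∀ c u v → u + v + (c - u - v) ≡ c
  cancel = solve-∀

≡-mod⇒≡+* : ∀ {m a b} → a ≡ b [mod m ] → Σ ℤ λ k → a ≡ b + m * k
≡-mod⇒≡+* {m} {a} {b} (≡-mod (divides k a-b≡k*m)) = k , (begin
  a           ≡⟨ a≡b+[a-b] a b ⟩
  b + (a - b) ≡⟨ cong (_+_ b) (trans a-b≡k*m (ℤ.*-comm k m)) ⟩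
  b + m * k   ∎)
  where
  open ≡-Reasoning
  a≡b+[a-b] : ∀ a b → a ≡ b + (a - b)
  a≡b+[a-b] = solve-∀

≡-mod⇒≡[mod] : ∀ {m p q} → (∀ n → p n ≡ q n [mod m ]) → p ≡[mod m ] q
≡-mod⇒≡[mod] p≡q n = ∣⇒∣ᵤ (divides-difference (p≡q n))

≗⊕scale⇒≡-mod : ∀ {m p q s} → p ≗ q ⊕ scale m s → ∀ n → p n ≡ q n [mod m ]
≗⊕scale⇒≡-mod {m} {p} {q} {s} p≗ n =
  ≡-mod-trans (≡-mod-reflexive (p≗ n)) (+-*-≡-mod m (q n) (s n))

≡-mod⇒≗⊕scale : ∀ {m p q} → (∀ n → p n ≡ q n [mod m ]) → Σ Series λ s → p ≗ q ⊕ scale m s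
≡-mod⇒≗⊕scale p≡q = (λ n → proj₁ (≡-mod⇒≡+* (p≡q n))) , (λ n → proj₂ (≡-mod⇒≡+* (p≡q n)))

-- Cubes modulo 3 and 9

open CommutativeSemiring series-commutativeSemiring using (semiring) renaming (setoid to ≗-setoid)
open import Algebra.Properties.Semiring.Mult.TCOptimised semiring using () renaming (_×_ to _×ₛ_)
open import Algebra.Solver.Ring.NaturalCoefficients.Default series-commutativeSemiring
  using (solve; _:+_; _:*_; con; _:=_)

infix 8 _³

_³ : Series → Series
p ³ = p ⊛ (p ⊛ p)

cube≗³ : ∀ p → cube p ≗ p ³
cube≗³ p n = trans (⋆≗⊛ p (p ⋆ p) n) (⊛-cong (λ _ → refl) (⋆≗⊛ p p) n)

³-cong : ∀ {p q} → p ≗ q → p ³ ≗ q ³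
³-cong p≗q = ⊛-cong p≗q (⊛-cong p≗q p≗q)

-- The ring solver interprets a numeral n as n ×ₛ 1ₛ.
×ₛ1ₛ≗const : ∀ n → n ×ₛ 1ₛ ≗ const (+ n)
×ₛ1ₛ≗const zero          zero    = refl
×ₛ1ₛ≗const zero          (suc k) = refl
×ₛ1ₛ≗const (suc zero)    k       = refl
×ₛ1ₛ≗const (suc (suc n)) zero    =
  trans (cong (_+ 1ℤ) (×ₛ1ₛ≗const (suc n) 0)) (cong +_ (ℕ.+-comm (suc n) 1))
×ₛ1ₛ≗const (suc (suc n)) (suc k) = cong (_+ 0ℤ) (×ₛ1ₛ≗const (suc n) (suc k))

×ₛ1ₛ-⊛ : ∀ n p → (n ×ₛ 1ₛ) ⊛ p ≗ scale (+ n) p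
×ₛ1ₛ-⊛ n p k = trans (⊛-cong (×ₛ1ₛ≗const n) (λ _ → refl) k) (const-⊛ (+ n) p k)

³-⊕-≡-mod3 : ∀ u v n → ((u ⊕ v) ³) n ≡ (u ³ ⊕ v ³) n [mod + 3 ]
³-⊕-≡-mod3 u v = ≗⊕scale⇒≡-mod (begin
  (u ⊕ v) ³                          ≈⟨ expand u v ⟩
  u ³ ⊕ v ³ ⊕ (3 ×ₛ 1ₛ) ⊛ mixed         ≈⟨ ⊕-congˡ (u ³ ⊕ v ³) (×ₛ1ₛ-⊛ 3 mixed) ⟩
  u ³ ⊕ v ³ ⊕ scale (+ 3) mixed       ∎)
  where
  open import Relation.Binary.Reasoning.Setoid ≗-setoid
  mixed : Series
  mixed = u ⊛ (u ⊛ v) ⊕ u ⊛ (v ⊛ v)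
  expand : ∀ u v → (u ⊕ v) ³ ≗ u ³ ⊕ v ³ ⊕ (3 ×ₛ 1ₛ) ⊛ (u ⊛ (u ⊛ v) ⊕ u ⊛ (v ⊛ v))
  expand = solve 2 (λ u v → (u :+ v) :* ((u :+ v) :* (u :+ v))
                         := u :* (u :* u) :+ v :* (v :* v) :+ con 3 :* (u :* (u :* v) :+ u :* (v :* v)))
                   (λ _ → refl)

≡-mod3⇒³-≡-mod9 : ∀ {p q} → (∀ n → p n ≡ q n [mod + 3 ]) → ∀ n → (p ³) n ≡ (q ³) n [mod + 9 ]
≡-mod3⇒³-≡-mod9 {p} {q} p≡q with ≡-mod⇒≗⊕scale p≡q
... | d , p≗q+3d = ≗⊕scale⇒≡-mod (begin
  p ³                                ≈⟨ ³-cong p≗q+3d ⟩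
  (q ⊕ scale (+ 3) d) ³              ≈⟨ ³-cong (⊕-congˡ q (×ₛ1ₛ-⊛ 3 d)) ⟨
  (q ⊕ (3 ×ₛ 1ₛ) ⊛ d) ³               ≈⟨ expand q d ⟩
  q ³ ⊕ (9 ×ₛ 1ₛ) ⊛ rest              ≈⟨ ⊕-congˡ (q ³) (×ₛ1ₛ-⊛ 9 rest) ⟩
  q ³ ⊕ scale (+ 9) rest             ∎)
  where
  open import Relation.Binary.Reasoning.Setoid ≗-setoid
  rest : Series
  rest = q ⊛ (q ⊛ d) ⊕ (3 ×ₛ 1ₛ) ⊛ (q ⊛ (d ⊛ d) ⊕ d ⊛ (d ⊛ d))
  expand : ∀ q d → (q ⊕ (3 ×ₛ 1ₛ) ⊛ d) ³
                 ≗ q ³ ⊕ (9 ×ₛ 1ₛ) ⊛ (q ⊛ (q ⊛ d) ⊕ (3 ×ₛ 1ₛ) ⊛ (q ⊛ (d ⊛ d) ⊕ d ⊛ (d ⊛ d)))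
  expand = solve 2 (λ q d → (q :+ con 3 :* d) :* ((q :+ con 3 :* d) :* (q :+ con 3 :* d))
                         := q :* (q :* q) :+ con 9 :* (q :* (q :* d) :+ con 3 :* (q :* (d :* d) :+ d :* (d :* d))))
                   (λ _ → refl)

shift-³ : ∀ p → shift p ³ ≗ shift (shift (shift (p ³)))
shift-³ p = begin
  shift p ⊛ (shift p ⊛ shift p)                ≈⟨ shift-⊛ p _ ⟩
  shift (p ⊛ (shift p ⊛ shift p))              ≈⟨ shift-cong (⊛-cong (λ _ → refl) (shift-⊛ p _)) ⟩
  shift (p ⊛ shift (p ⊛ shift p))              ≈⟨ shift-cong (⊛-shift p _) ⟩
  shift (shift (p ⊛ (p ⊛ shift p)))            ≈⟨ shift-cong (shift-cong (⊛-cong (λ _ → refl) (⊛-shift p p))) ⟩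
  shift (shift (p ⊛ shift (p ⊛ p)))            ≈⟨ shift-cong (shift-cong (⊛-shift p _)) ⟩
  shift (shift (shift (p ³)))                  ∎
  where open import Relation.Binary.Reasoning.Setoid ≗-setoid

const-³ : ∀ c → const c ³ ≗ const (c * (c * c))
const-³ c n = trans (⊛-cong (λ _ → refl) (const-⊛-const c c) n) (const-⊛-const c (c * c) n)

³-head-tail-≡-mod3 : ∀ p n → (p ³) n ≡ (const (p 0 * (p 0 * p 0)) ⊕ shift (shift (shift (tail p ³)))) n [mod + 3 ]
³-head-tail-≡-mod3 p n = begin
  (p ³) n                                      ≡⟨ ³-cong (≗const⊕shift-tail p) n ⟩
  ((const (p 0) ⊕ shift (tail p)) ³) n         ≈⟨ ³-⊕-≡-mod3 (const (p 0)) (shift (tail p)) n ⟩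
  (const (p 0) ³ ⊕ shift (tail p) ³) n         ≡⟨ cong₂ _+_ (const-³ (p 0) n) (shift-³ (tail p) n) ⟩
  (const (p 0 * (p 0 * p 0)) ⊕ shift (shift (shift (tail p ³)))) n ∎
  where open import Relation.Binary.Reasoning.Setoid (≡-mod-setoid (+ 3))

x³≡x-mod3 : ∀ x → x * (x * x) ≡ x [mod + 3 ]
x³≡x-mod3 (+ n)      = ≡-mod (3∣n³-n n)
  where
  [1+x]³-[1+x] : ∀ x → x * (x * x) - x + (x * x + x) * + 3 ≡ (+ 1 + x) * ((+ 1 + x) * (+ 1 + x)) - (+ 1 + x)
  [1+x]³-[1+x] = solve-∀
  3∣n³-n : ∀ n → + 3 ∣ + n * (+ n * + n) - + n
  3∣n³-n zero    = divides 0ℤ refl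
  3∣n³-n (suc n) =
    subst (+ 3 ∣_) ([1+x]³-[1+x] (+ n)) (∣m∣n⇒∣m+n (3∣n³-n n) (divides (+ n * + n + + n) refl))
x³≡x-mod3 -[1+ n ] =
  ≡-mod (subst (+ 3 ∣_) (-[x³-x] (+ suc n)) (∣m⇒∣-m (divides-difference (x³≡x-mod3 (+ suc n)))))
  where
  -[x³-x] : ∀ x → - (x * (x * x) - x) ≡ - x * (- x * - x) - - x
  -[x³-x] = solve-∀

subst-x³-suc³ : ∀ p m → subst-x³ p (suc (suc (suc m))) ≡ subst-x³ (tail p) m
subst-x³-suc³ p m =
  cong (λ k → if ⌊ m ℕ.% 3 ℕ.≟ 0 ⌋ then p k else 0ℤ) (ℕ.m/n≡1+[m∸n]/n (ℕ.m≤m+n 3 m))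

³-≡-mod3-subst-x³ : ∀ p n → (p ³) n ≡ subst-x³ p n [mod + 3 ]
-- For n = 1, 2 the right-hand side of the head-tail congruence computes to 0ℤ = subst-x³ p n.
³-≡-mod3-subst-x³ p zero                = x³≡x-mod3 (p 0)
³-≡-mod3-subst-x³ p (suc zero)          = ³-head-tail-≡-mod3 p 1
³-≡-mod3-subst-x³ p (suc (suc zero))    = ³-head-tail-≡-mod3 p 2
³-≡-mod3-subst-x³ p (suc (suc (suc m))) = begin
  (p ³) (suc (suc (suc m)))      ≈⟨ ³-head-tail-≡-mod3 p (suc (suc (suc m))) ⟩
  0ℤ + (tail p ³) m              ≡⟨ ℤ.+-identityˡ _ ⟩
  (tail p ³) m                   ≈⟨ ³-≡-mod3-subst-x³ (tail p) m ⟩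
  subst-x³ (tail p) m            ≡⟨ subst-x³-suc³ p m ⟨
  subst-x³ p (suc (suc (suc m))) ∎
  where open import Relation.Binary.Reasoning.Setoid (≡-mod-setoid (+ 3))

-- Residues modulo 3

subst-x³-preserves : ∀ (P : ℤ → Set) {p} → P 0ℤ → (∀ n → P (p n)) → ∀ n → P (subst-x³ p n)
subst-x³-preserves P {p} P0 Pp n = P-if ⌊ n ℕ.% 3 ℕ.≟ 0 ⌋
  where
  P-if : ∀ b → P (if b then p (n ℕ./ 3) else 0ℤ)
  P-if true  = Pp (n ℕ./ 3)
  P-if false = P0

subst-x³-indicator : ∀ {c} → c ≢ 0ℤ → ∀ p → subst-x³ (indicator c p) ≗ indicator c (subst-x³ p)
subst-x³-indicator {c} c≢0 p n = sym (begin
  𝟙 (if b then p (n ℕ./ 3) else 0ℤ)        ≡⟨ if-float 𝟙 b ⟩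
  (if b then 𝟙 (p (n ℕ./ 3)) else 𝟙 0ℤ)    ≡⟨ if-cong-else b (cong (if_then + 1 else + 0) 0≠c) ⟩
  (if b then 𝟙 (p (n ℕ./ 3)) else 0ℤ)      ∎)
  where
  open ≡-Reasoning
  b : Bool
  b = ⌊ n ℕ.% 3 ℕ.≟ 0 ⌋
  𝟙 : ℤ → ℤ
  𝟙 v = if ⌊ v ℤ.≟ c ⌋ then + 1 else + 0
  0≠c : ⌊ 0ℤ ℤ.≟ c ⌋ ≡ false
  0≠c = trans (isYes≗does (0ℤ ℤ.≟ c)) (dec-false (0ℤ ℤ.≟ c) (c≢0 ∘ sym))

mod3-≡-mod3 : ∀ p n → p n ≡ mod3 p n [mod + 3 ]
mod3-≡-mod3 p = ≗⊕scale⇒≡-mod {s = λ n → p n ℤ./ℕ 3} λ n →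
  trans (a≡a%ℕn+[a/ℕn]*n (p n) 3) (cong (_+_ (mod3 p n)) (ℤ.*-comm (p n ℤ./ℕ 3) (+ 3)))

infix 4 _∈[0,2] _∈[1,3]

_∈[0,2] _∈[1,3] : ℤ → Set
v ∈[0,2] = v ≡ + 0 ⊎ v ≡ + 1 ⊎ v ≡ + 2
x ∈[1,3] = x ≡ + 1 ⊎ x ≡ + 2 ⊎ x ≡ + 3

mod3∈[0,2] : ∀ p n → mod3 p n ∈[0,2]
mod3∈[0,2] p n = <3⇒∈[0,2] (n%ℕd<d (p n) 3)
  where
  <3⇒∈[0,2] : ∀ {r} → r ℕ.< 3 → + r ∈[0,2]
  <3⇒∈[0,2] {0} _ = inj₁ refl
  <3⇒∈[0,2] {1} _ = inj₂ (inj₁ refl)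
  <3⇒∈[0,2] {2} _ = inj₂ (inj₂ refl)
  <3⇒∈[0,2] {suc (suc (suc r))} (ℕ.s≤s (ℕ.s≤s (ℕ.s≤s ())))

-- Maps the residues 0, 1, 2 to 3, 1, 2; written so that representative (p n) unfolds to
-- + 3 - + 2 * indicator (+ 1) p n - indicator (+ 2) p n.
representative : ℤ → ℤ
representative v = + 3 - + 2 * indicator (+ 1) (λ _ → v) 0 - indicator (+ 2) (λ _ → v) 0

≢-mod : ∀ {m a b} → False (m ∣? a - b) → ¬ a ≡ b [mod m ]
≢-mod m∤a-b (≡-mod m∣a-b) = toWitnessFalse m∤a-b m∣a-b

≡-mod3⇒≡-representative : ∀ {x v} → x ∈[1,3] → v ∈[0,2] → x ≡ v [mod + 3 ] → x ≡ representative v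
≡-mod3⇒≡-representative (inj₁ refl)        (inj₂ (inj₁ refl)) _   = refl
≡-mod3⇒≡-representative (inj₂ (inj₁ refl)) (inj₂ (inj₂ refl)) _   = refl
≡-mod3⇒≡-representative (inj₂ (inj₂ refl)) (inj₁ refl)        _   = refl
≡-mod3⇒≡-representative (inj₁ refl)        (inj₁ refl)        x≡v = contradiction x≡v (≢-mod _)
≡-mod3⇒≡-representative (inj₁ refl)        (inj₂ (inj₂ refl)) x≡v = contradiction x≡v (≢-mod _)
≡-mod3⇒≡-representative (inj₂ (inj₁ refl)) (inj₁ refl)        x≡v = contradiction x≡v (≢-mod _)
≡-mod3⇒≡-representative (inj₂ (inj₁ refl)) (inj₂ (inj₁ refl)) x≡v = contradiction x≡v (≢-mod _)
≡-mod3⇒≡-representative (inj₂ (inj₂ refl)) (inj₂ (inj₁ refl)) x≡v = contradiction x≡v (≢-mod _)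
≡-mod3⇒≡-representative (inj₂ (inj₂ refl)) (inj₂ (inj₂ refl)) x≡v = contradiction x≡v (≢-mod _)

≡-mod3-subst-x³⇒≡ : ∀ {x g} n → x ∈[1,3] → (∀ k → g k ∈[0,2]) → x ≡ subst-x³ g n [mod + 3 ] →
                    x ≡ + 3 - + 2 * subst-x³ (indicator (+ 1) g) n - subst-x³ (indicator (+ 2) g) n
≡-mod3-subst-x³⇒≡ {g = g} n x∈[1,3] g∈[0,2] x≡g[x³] =
  trans (≡-mod3⇒≡-representative x∈[1,3] g[x³]∈[0,2] x≡g[x³])
        (cong₂ (λ u v → + 3 - + 2 * u - v) (sym (subst-x³-indicator (λ ()) g n))
                                           (sym (subst-x³-indicator (λ ()) g n)))
  where
  g[x³]∈[0,2] : subst-x³ g n ∈[0,2]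
  g[x³]∈[0,2] = subst-x³-preserves _∈[0,2] (inj₁ refl) g∈[0,2] n

theorem22 : (f a : Series) →
              f 0 ≡ + 1 →
              (∀ n → f (suc n) ≡ + 1 ⊎ f (suc n) ≡ + 2 ⊎ f (suc n) ≡ + 3) →
              InR a → (∀ n → cube a n ≡ f n) →
              let g  = mod3 a
                  g₊ = indicator (+ 1) g
                  g₋ = indicator (+ 2) g
              in g 0 ≡ + 1
                 × ((λ n → + 2 * subst-x³ g₊ n + subst-x³ g₋ n + cube g n) ≡[mod + 9 ] three/1-x)
                 × (f ≡[mod + 9 ] (λ n → three/1-x n - + 2 * subst-x³ g₊ n - subst-x³ g₋ n))
theorem22 f a f0 f∈[1,3]⁺ a0 cube-a≡f = g0 , ≡-mod⇒≡[mod] g-congruence , ≡-mod⇒≡[mod] f-congruence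
  where
  g s₊ s₋ : Series
  g  = mod3 a
  s₊ = subst-x³ (indicator (+ 1) g)
  s₋ = subst-x³ (indicator (+ 2) g)

  g0 : g 0 ≡ + 1
  g0 = cong (λ a₀ → + (a₀ ℤ.%ℕ 3)) a0

  f∈[1,3] : ∀ n → f n ∈[1,3]
  f∈[1,3] zero    = inj₁ f0
  f∈[1,3] (suc n) = f∈[1,3]⁺ n

  f≡g³ : ∀ n → f n ≡ (g ³) n [mod + 9 ]
  f≡g³ n = ≡-mod-trans (≡-mod-reflexive (trans (sym (cube-a≡f n)) (cube≗³ a n)))
                       (≡-mod3⇒³-≡-mod9 (mod3-≡-mod3 a) n)

  f≡R : ∀ n → f n ≡ + 3 - + 2 * s₊ n - s₋ n
  f≡R n = ≡-mod3-subst-x³⇒≡ n (f∈[1,3] n) (mod3∈[0,2] a)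
            (≡-mod-trans (≡-mod-weaken (divides (+ 3) refl) (f≡g³ n)) (³-≡-mod3-subst-x³ g n))

  f-congruence : ∀ n → f n ≡ + 3 - + 2 * s₊ n - s₋ n [mod + 9 ]
  f-congruence n = ≡-mod-reflexive (f≡R n)

  g-congruence : ∀ n → + 2 * s₊ n + s₋ n + cube g n ≡ + 3 [mod + 9 ]
  g-congruence n = ≡-mod-rearrange (+ 3) (+ 2 * s₊ n) (s₋ n)
                     (≡-mod-trans (f≡g³ n) (≡-mod-reflexive (sym (cube≗³ g n)))) (f≡R n)
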